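{- Let $p<q$ be positive integers with $q-p$ even, let $b=\frac{q-p}{2}$, and assume $p\ge 2b$. Then the set $\{1,\dots,b\}\cup\{p+b+1,\dots,q\}$ is consistent with respect to the control sequence for $(p,q)$.
   Context: The control sequence for $(p,q)$ is the infinite sequence of brackets $\beta_1,\beta_2,\dots$, where $\beta_j\subseteq\{1,\dots,q\}$ consists of the numbers $(j-1)b+1,\dots,(j-1)b+p$, each reduced modulo $q$ into $\{1,\dots,q\}$. For $x\in\beta_j$, its occurrence number in bracket $j$ is $|\{j'\le j:x\in\beta_{j'}\}|$. Numbers $x,y$ are in contradiction in bracket $j$ if $x,y\in\beta_j$ and the occurrence number of $y$ in bracket $j$ equals that of $x$ plus $2$. A subset of $\{1,\dots,q\}$ is consistent if no two of its elements are in contradiction in any bracket. -}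

module Defs where

open import Data.Nat using (ℕ; zero; suc; _+_; _*_; _∸_; _≤_; _<_; _%_; NonZero)
open import Data.Nat.Properties using (_≟_)
open import Data.Bool using (Bool; true; false; _∨_; if_then_else_)
open import Relation.Nullary.Decidable using (⌊_⌋)
open import Relation.Binary.PropositionalEquality using (_≡_)

red : (q : ℕ) .{{_ : NonZero q}} → ℕ → ℕ
red q n = suc ((n ∸ 1) % q)

anyUpTo : ℕ → (ℕ → Bool) → Bool
anyUpTo zero    f = false
anyUpTo (suc k) f = anyUpTo k f ∨ f (suc k)

countUpTo : ℕ → (ℕ → Bool) → ℕ
countUpTo zero    f = 0
countUpTo (suc k) f = countUpTo k f + (if f (suc k) then 1 else 0)

-- Bracket β_j (j ≥ 1) of the control sequence for (p,q) with step b: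
-- β_j = { red q ((j-1)b + i) : 1 ≤ i ≤ p }.  inBracket tests x ∈ β_j.
inBracket : (p q b : ℕ) .{{_ : NonZero q}} → ℕ → ℕ → Bool
inBracket p q b j x = anyUpTo p (λ i → ⌊ red q ((j ∸ 1) * b + i) ≟ x ⌋)

occ : (p q b : ℕ) .{{_ : NonZero q}} → ℕ → ℕ → ℕ
occ p q b j x = countUpTo j (λ j' → inBracket p q b j' x)

Contradiction : (p q b : ℕ) .{{_ : NonZero q}} → ℕ → ℕ → ℕ → Set
Contradiction p q b j x y =
  inBracket p q b j x ≡ true × inBracket p q b j y ≡ true × occ p q b j y ≡ occ p q b j x + 2
  where open import Data.Product using (_×_)

Consistent : (p q b : ℕ) .{{_ : NonZero q}} → (ℕ → Set) → Set
Consistent p q b S =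
  ∀ (j x y : ℕ) → 1 ≤ j → S x → S y → Contradiction p q b j x y → ⊥
  where open import Data.Empty using (⊥)

TheSet : (p q b : ℕ) → ℕ → Set
TheSet p q b x = (1 ≤ x × x ≤ b) ⊎ (p + b + 1 ≤ x × x ≤ q)
  where open import Data.Product using (_×_)
        open import Data.Sum using (_⊎_)

-- Bracket j consists of the p residues following (j − 1)b modulo q, so x misses it exactly when
-- jb mod q lies in a window [t, t + 2b) determined by x: for x in the set, t = x + b if x ≤ b and
-- t = x − p − b otherwise, so 1 ≤ t ≤ 2b and the window does not wrap around (4b ≤ q).
-- As jb advances by b, each lap around ℤ/q passes the window exactly twice, so among the first j
-- brackets x is missing from 2⌊jb/q⌋ + c_t(jb mod q) of them, where c_t(r) = [t ≤ r] + [t + b ≤ r].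
-- A contradiction occ(j, y) = occ(j, x) + 2 forces c_{t_x}(r) = 2 and c_{t_y}(r) = 0, i.e.
-- t_x + b ≤ r < t_y ≤ 2b, which puts r = jb mod q in the window of x: x is not in bracket j.

module Submission where

open import Defs
open import Data.Bool using (Bool; true; false; not; if_then_else_)
open import Data.Bool.Properties using (∨-zeroʳ; ∨-identityʳ; ∧-identityʳ)
open import Data.Nat
open import Data.Nat.Properties
open import Data.Nat.DivMod
open import Data.Nat.Divisibility using (n∣m*n)
open import Data.Nat.Tactic.RingSolver using (solve-∀)
open import Algebra.Properties.CommutativeSemigroup +-commutativeSemigroup using (interchange; xy∙z≈xz∙y; x∙yz≈yx∙z; x∙yz≈xz∙y; x∙yz≈y∙xz)
open import Data.Product using (∃-syntax; _×_; _,_; proj₁; proj₂)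
open import Data.Sum using (_⊎_; inj₁; inj₂)
open import Function.Bundles using (_⇔_; mk⇔; Equivalence)
open import Function.Construct.Composition using (_⇔-∘_)
open import Relation.Nullary using (¬_; Dec; yes; no; does; contradiction)
open import Relation.Nullary.Decidable using (⌊_⌋; _×-dec_; dec-true; dec-false; does-⇔)
open import Relation.Binary.PropositionalEquality

n≤m+2n : ∀ m n → n ≤ m + 2 * n
n≤m+2n m n = ≤-trans (m≤m+n n (n + 0)) (m≤n+m (2 * n) m)

m+2n≡m+n+n : ∀ m n → m + 2 * n ≡ m + n + n
m+2n≡m+n+n m n = trans (cong (λ k → m + (n + k)) (+-identityʳ n)) (sym (+-assoc m n n))

divMod-unique : ∀ {q r k} .{{_ : NonZero q}} → r < q → (r + k * q) % q ≡ r × (r + k * q) / q ≡ k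
divMod-unique {q} {r} {k} r<q =
  trans ([m+kn]%n≡m%n r k q) (m<n⇒m%n≡m r<q) ,
  (begin
    (r + k * q) / q      ≡⟨ +-distrib-/-∣ʳ r (n∣m*n k) ⟩
    r / q + k * q / q    ≡⟨ cong₂ _+_ (m<n⇒m/n≡0 r<q) (m*n/n≡m k q) ⟩
    k                    ∎)
  where open ≡-Reasoning

≡-not-does : ∀ {β : Bool} {A : Set} → (β ≡ true ⇔ (¬ A)) → (a? : Dec A) → β ≡ not (does a?)
≡-not-does {true}  β⇔¬A (yes a)  = contradiction a (Equivalence.to β⇔¬A refl)
≡-not-does {false} _    (yes _)  = refl
≡-not-does {true}  _    (no _)   = refl
≡-not-does {false} β⇔¬A (no ¬a)  = Equivalence.from β⇔¬A ¬a

𝟙 : Bool → ℕ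
𝟙 β = if β then 1 else 0

𝟙-gap : ∀ {A B C D : Set} (a? : Dec A) (b? : Dec B) (c? : Dec C) (d? : Dec D) →
        𝟙 (does a?) + 𝟙 (does b?) ≡ 2 + (𝟙 (does c?) + 𝟙 (does d?)) → B × ¬ C
𝟙-gap (yes _) (yes b) (no ¬c) (no _)  _  = b , ¬c
𝟙-gap (yes _) (yes _) (no _)  (yes _) ()
𝟙-gap (yes _) (yes _) (yes _) _       ()
𝟙-gap (yes _) (no _)  _       _       ()
𝟙-gap (no _)  (yes _) _       _       ()
𝟙-gap (no _)  (no _)  _       _       ()

𝟙-not : ∀ β → 𝟙 (not β) + 𝟙 β ≡ 1
𝟙-not true  = refl
𝟙-not false = refl

module _ {P : ℕ → Set} (P? : ∀ i → Dec (P i)) where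

  anyUpTo-sound : ∀ k → anyUpTo k (λ i → ⌊ P? i ⌋) ≡ true → ∃[ i ] (1 ≤ i × i ≤ k × P i)
  anyUpTo-sound (suc k) any with P? (suc k)
  ... | yes Pk = suc k , s≤s z≤n , ≤-refl , Pk
  ... | no _ with anyUpTo-sound k (trans (sym (∨-identityʳ _)) any)
  ...   | i , 1≤i , i≤k , Pi = i , 1≤i , m≤n⇒m≤1+n i≤k , Pi

  anyUpTo-complete : ∀ {k i} → 1 ≤ i → i ≤ k → P i → anyUpTo k (λ i → ⌊ P? i ⌋) ≡ true
  anyUpTo-complete {zero}  ()  z≤n  _
  anyUpTo-complete {suc k} 1≤i i≤1+k Pi with m≤n⇒m<n∨m≡n i≤1+k
  ... | inj₁ i<1+k rewrite anyUpTo-complete 1≤i (≤-pred i<1+k) Pi = refl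
  ... | inj₂ refl with P? (suc k)
  ...   | yes _ = ∨-zeroʳ _
  ...   | no ¬Pi = contradiction Pi ¬Pi

countUpTo-complement : ∀ k {f g : ℕ → Bool} → (∀ i → f (suc i) ≡ not (g (suc i))) →
                       countUpTo k f + countUpTo k g ≡ k
countUpTo-complement zero    f≡¬g = refl
countUpTo-complement (suc k) {f} {g} f≡¬g = begin
  countUpTo k f + 𝟙 (f (suc k)) + (countUpTo k g + 𝟙 (g (suc k)))
    ≡⟨ interchange (countUpTo k f) _ _ _ ⟩
  countUpTo k f + countUpTo k g + (𝟙 (f (suc k)) + 𝟙 (g (suc k)))
    ≡⟨ cong₂ _+_ (countUpTo-complement k f≡¬g) (cong (λ β → 𝟙 β + 𝟙 (g (suc k))) (f≡¬g k)) ⟩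
  k + (𝟙 (not (g (suc k))) + 𝟙 (g (suc k)))
    ≡⟨ cong (k +_) (𝟙-not (g (suc k))) ⟩
  k + 1
    ≡⟨ +-comm k 1 ⟩
  suc k ∎
  where open ≡-Reasoning

module Reduction (q : ℕ) .{{_ : NonZero q}} where

  red-id : ∀ {y} → y < q → red q (suc y) ≡ suc y
  red-id y<q = cong suc (m<n⇒m%n≡m y<q)

  red-+q : ∀ y → red q (suc y + q) ≡ red q (suc y)
  red-+q y = cong suc ([m+n]%n≡m%n y q)

  red-% : ∀ n i → red q (n + suc i) ≡ red q (n % q + suc i)
  red-% n i = begin
    red q (n + suc i)                  ≡⟨ cong (red q) (+-suc n i) ⟩
    suc ((n + i) % q)                  ≡⟨ cong (λ m → suc ((m + i) % q)) (m≡m%n+[m/n]*n n q) ⟩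
    suc ((n % q + n / q * q + i) % q)  ≡⟨ cong (λ m → suc (m % q)) (xy∙z≈xz∙y (n % q) _ i) ⟩
    suc ((n % q + i + n / q * q) % q)  ≡⟨ cong suc ([m+kn]%n≡m%n (n % q + i) (n / q) q) ⟩
    suc ((n % q + i) % q)              ≡⟨ cong (red q) (+-suc (n % q) i) ⟨
    red q (n % q + suc i)              ∎
    where open ≡-Reasoning

  -- x ≡ s + i (mod q) for some 1 ≤ i ≤ p, with x represented in {1, …, q}.
  Arc : (p s x : ℕ) → Set
  Arc p s x = s < x × x ≤ s + p ⊎ x + q ≤ s + p

  red≡⇒arc : ∀ {p s i x} → p ≤ q → s < q → 1 ≤ i → i ≤ p → red q (s + i) ≡ x → Arc p s x
  red≡⇒arc {p} {s} {suc i} {x} p≤q s<q _ 1+i≤p hit with s + i <? q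
  ... | yes s+i<q = inj₁ (subst (s <_) x≡ (m<m+n s z<s) , subst (_≤ s + p) x≡ (+-monoʳ-≤ s 1+i≤p))
    where
      x≡ : s + suc i ≡ x
      x≡ = trans (trans (+-suc s i) (sym (red-id s+i<q))) (trans (cong (red q) (sym (+-suc s i))) hit)
  ... | no s+i≮q = inj₂ (subst (λ y → y + q ≤ s + p) x≡ (subst (_≤ s + p) s+1+i≡ (+-monoʳ-≤ s 1+i≤p)))
    where
      z = s + i ∸ q
      z+q≡ : z + q ≡ s + i
      z+q≡ = m∸n+n≡m (≮⇒≥ s+i≮q)
      z<q : z < q
      z<q = +-cancelʳ-< q z q (subst (_< q + q) (sym z+q≡) (+-mono-< s<q (<-≤-trans 1+i≤p p≤q)))
      s+1+i≡ : s + suc i ≡ suc z + q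
      s+1+i≡ = trans (+-suc s i) (cong suc (sym z+q≡))
      x≡ : suc z ≡ x
      x≡ = begin
        suc z                ≡⟨ red-id z<q ⟨
        red q (suc z)        ≡⟨ red-+q z ⟨
        red q (suc z + q)    ≡⟨ cong (red q) s+1+i≡ ⟨
        red q (s + suc i)    ≡⟨ hit ⟩
        x                    ∎
        where open ≡-Reasoning

  arc⇒red≡ : ∀ {p s x} → s < q → 1 ≤ x → x ≤ q → Arc p s x → ∃[ i ] (1 ≤ i × i ≤ p × red q (s + i) ≡ x)
  arc⇒red≡ {s = s} {x = x@(suc x′)} s<q _ x≤q (inj₁ (s<x , x≤s+p)) =
    x ∸ s , m<n⇒0<n∸m s<x , m≤n+o⇒m∸n≤o x s x≤s+p ,
    trans (cong (red q) (m+[n∸m]≡n (<⇒≤ s<x))) (red-id x≤q)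
  arc⇒red≡ {s = s} {x = x@(suc x′)} s<q _ x≤q (inj₂ x+q≤s+p) =
    x + q ∸ s , m<n⇒0<n∸m s<x+q , m≤n+o⇒m∸n≤o (x + q) s x+q≤s+p ,
    trans (cong (red q) (m+[n∸m]≡n (<⇒≤ s<x+q))) (trans (red-+q x′) (red-id x≤q))
    where s<x+q = <-≤-trans s<q (m≤n+m q x)

  bracket⇔arc : ∀ {p n x} → p ≤ q → 1 ≤ x → x ≤ q →
                anyUpTo p (λ i → ⌊ red q (n + i) ≟ x ⌋) ≡ true ⇔ Arc p (n % q) x
  bracket⇔arc {p} {n} {x} p≤q 1≤x x≤q = mk⇔ to from
    where
      to : anyUpTo p (λ i → ⌊ red q (n + i) ≟ x ⌋) ≡ true → Arc p (n % q) x
      to any with anyUpTo-sound (λ i → red q (n + i) ≟ x) p any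
      ... | suc i , 1≤i , i≤p , hit = red≡⇒arc p≤q (m%n<n n q) 1≤i i≤p (trans (sym (red-% n i)) hit)
      from : Arc p (n % q) x → anyUpTo p (λ i → ⌊ red q (n + i) ≟ x ⌋) ≡ true
      from arc with arc⇒red≡ (m%n<n n q) 1≤x x≤q arc
      ... | suc i , 1≤i , i≤p , hit = anyUpTo-complete (λ i → red q (n + i) ≟ x) 1≤i i≤p (trans (red-% n i) hit)

module Windows (b q : ℕ) .{{_ : NonZero q}} where

  Window : ℕ → ℕ → Set
  Window t r = t ≤ r × r < t + 2 * b

  window? : ∀ t r → Dec (Window t r)
  window? t r = t ≤? r ×-dec r <? t + 2 * b

  window-shift : ∀ {t r} c → Window (t + c) (r + c) ⇔ Window t r
  window-shift {t} {r} c = mk⇔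
    (λ (t+c≤r+c , r+c<) → +-cancelʳ-≤ c t r t+c≤r+c , +-cancelʳ-< c r (t + 2 * b) (subst (r + c <_) (xy∙z≈xz∙y t c (2 * b)) r+c<))
    (λ (t≤r , r<) → +-monoˡ-≤ c t≤r , subst (r + c <_) (sym (xy∙z≈xz∙y t c (2 * b))) (+-monoˡ-< c r<))

  hits : ℕ → ℕ → ℕ
  hits t m = countUpTo m (λ j → does (window? t (j * b % q)))

  -- The offsets r, r − b, r − 2b, … of the current lap that lie in the window of t.
  lapHits : ℕ → ℕ → ℕ
  lapHits t r = 𝟙 (does (t ≤? r)) + 𝟙 (does (t + b ≤? r))

  data Carry (n : ℕ) : Set where
    no-carry : (b + n) % q ≡ n % q + b → (b + n) / q ≡ n / q → Carry n
    carry    : (b + n) % q + q ≡ n % q + b → (b + n) / q ≡ suc (n / q) → Carry n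

  private
    b+n≡ : ∀ n → b + n ≡ n % q + b + n / q * q
    b+n≡ n = trans (cong (b +_) (m≡m%n+[m/n]*n n q)) (x∙yz≈yx∙z b (n % q) _)

  carry? : b ≤ q → ∀ n → Carry n
  carry? b≤q n with n % q + b <? q
  ... | yes s+b<q =
    no-carry (trans (cong (_% q) (b+n≡ n)) (proj₁ unique)) (trans (cong (_/ q) (b+n≡ n)) (proj₂ unique))
    where
      unique = divMod-unique {k = n / q} s+b<q
  ... | no s+b≮q =
    carry (trans (cong (_+ q) (trans (cong (_% q) b+n≡′) (proj₁ unique))) r+q≡)
          (trans (cong (_/ q) b+n≡′) (proj₂ unique))
    where
      r = n % q + b ∸ q
      r+q≡ : r + q ≡ n % q + b
      r+q≡ = m∸n+n≡m (≮⇒≥ s+b≮q)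
      r<q : r < q
      r<q = +-cancelʳ-< q r q (subst (_< q + q) (sym r+q≡) (+-mono-<-≤ (m%n<n n q) b≤q))
      b+n≡′ : b + n ≡ r + suc (n / q) * q
      b+n≡′ = trans (b+n≡ n) (trans (cong (_+ n / q * q) (sym r+q≡)) (+-assoc r q _))
      unique = divMod-unique {k = suc (n / q)} r<q

  carry⇒r<b : ∀ {r s} → s < q → r + q ≡ s + b → r < b
  carry⇒r<b {r} {s} s<q r+q≡ =
    +-cancelʳ-< q r b (subst (_< b + q) (sym r+q≡) (subst (s + b <_) (+-comm q b) (+-monoˡ-< b s<q)))

  carry⇒≤ : ∀ {c r s} → c + b ≤ q → r + q ≡ s + b → c ≤ s
  carry⇒≤ {c} {r} {s} c+b≤q r+q≡ =
    +-cancelʳ-≤ b c s (≤-trans c+b≤q (subst (q ≤_) r+q≡ (m≤n+m q r)))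

  lapHits-no-carry : ∀ t s → lapHits t s + 𝟙 (does (window? t (s + b))) ≡ lapHits t (s + b)
  lapHits-no-carry t s with t + b ≤? s
  ... | yes t+b≤s
    rewrite dec-true (t + b ≤? s) t+b≤s
          | dec-true (t ≤? s) (≤-trans (m≤m+n t b) t+b≤s)
          | dec-true (t ≤? s + b) (≤-trans (m≤m+n t b) (≤-trans t+b≤s (m≤m+n s b)))
          | dec-true (t + b ≤? s + b) (+-monoˡ-≤ b (≤-trans (m≤m+n t b) t+b≤s))
          | dec-false (s + b <? t + 2 * b) (≤⇒≯ (subst (_≤ s + b) (sym (m+2n≡m+n+n t b)) (+-monoˡ-≤ b t+b≤s)))
          = refl
  ... | no t+b≰s
    rewrite dec-false (t + b ≤? s) t+b≰s
          | dec-true (s + b <? t + 2 * b) (subst (s + b <_) (sym (m+2n≡m+n+n t b)) (+-monoˡ-< b (≰⇒> t+b≰s)))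
          | ∧-identityʳ (does (t ≤? s + b))
          | does-⇔ (mk⇔ (+-cancelʳ-≤ b t s) (+-monoˡ-≤ b)) (t + b ≤? s + b) (t ≤? s)
          = trans (cong (_+ 𝟙 (does (t ≤? s + b))) (+-identityʳ (𝟙 (does (t ≤? s))))) (+-comm (𝟙 (does (t ≤? s))) _)

  lapHits-carry : ∀ {t r s} → t + 2 * b ≤ q → s < q → r + q ≡ s + b →
                  lapHits t s + 𝟙 (does (window? t r)) ≡ 2 + lapHits t r
  lapHits-carry {t} {r} {s} t+2b≤q s<q r+q≡
    with t+b+b≤q ← subst (_≤ q) (m+2n≡m+n+n t b) t+2b≤q
    rewrite dec-true (t ≤? s) (≤-trans (m≤m+n t b) (carry⇒≤ t+b+b≤q r+q≡))
          | dec-true (t + b ≤? s) (carry⇒≤ t+b+b≤q r+q≡)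
          | dec-false (t + b ≤? r) (<⇒≱ (<-≤-trans (carry⇒r<b s<q r+q≡) (m≤n+m b t)))
          | dec-true (r <? t + 2 * b) (<-≤-trans (carry⇒r<b s<q r+q≡) (n≤m+2n t b))
          | ∧-identityʳ (does (t ≤? r))
          = cong (2 +_) (sym (+-identityʳ _))

  lapHits-step : ∀ {t} → t + 2 * b ≤ q → ∀ n →
                 2 * (n / q) + lapHits t (n % q) + 𝟙 (does (window? t ((b + n) % q)))
                 ≡ 2 * ((b + n) / q) + lapHits t ((b + n) % q)
  lapHits-step {t} t+2b≤q n with carry? (≤-trans (n≤m+2n t b) t+2b≤q) n
  ... | no-carry r≡s+b k′≡k rewrite r≡s+b | k′≡k =
    trans (+-assoc (2 * (n / q)) _ _) (cong (2 * (n / q) +_) (lapHits-no-carry t (n % q)))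
  ... | carry r+q≡s+b k′≡1+k rewrite k′≡1+k = begin
    2 * k + lapHits t (n % q) + 𝟙 (does (window? t r))     ≡⟨ +-assoc (2 * k) _ _ ⟩
    2 * k + (lapHits t (n % q) + 𝟙 (does (window? t r)))   ≡⟨ cong (2 * k +_) (lapHits-carry {t} t+2b≤q (m%n<n n q) r+q≡s+b) ⟩
    2 * k + (2 + lapHits t r)                              ≡⟨ x∙yz≈y∙xz (2 * k) 2 _ ⟩
    2 + (2 * k + lapHits t r)                              ≡⟨ +-assoc 2 (2 * k) _ ⟨
    2 + 2 * k + lapHits t r                                ≡⟨ cong (_+ lapHits t r) (*-suc 2 k) ⟨
    2 * suc k + lapHits t r                                ∎
    where
      open ≡-Reasoning
      k = n / q
      r = (b + n) % q

  hits-formula : ∀ {t} → 1 ≤ t → t + 2 * b ≤ q → ∀ m → hits t m ≡ 2 * (m * b / q) + lapHits t (m * b % q)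
  hits-formula {suc t} _ _ zero =
    sym (cong₂ (λ k r → 2 * k + lapHits (suc t) r) (0/n≡0 q) (m<n⇒m%n≡m (>-nonZero⁻¹ q)))
  hits-formula {t} 1≤t t+2b≤q (suc m) =
    trans (cong (_+ 𝟙 (does (window? t (suc m * b % q)))) (hits-formula 1≤t t+2b≤q m))
          (lapHits-step {t} t+2b≤q (m * b))

  lapHits-gap : ∀ {t t' r} → t' ≤ 2 * b → lapHits t r ≡ 2 + lapHits t' r → Window t r
  lapHits-gap {t} {t'} {r} t'≤2b eq
    with t+b≤r , r<t' ← 𝟙-gap (t ≤? r) (t + b ≤? r) (t' ≤? r) (t' + b ≤? r) eq
    = ≤-trans (m≤m+n t b) t+b≤r , <-≤-trans (≰⇒> r<t') (≤-trans t'≤2b (m≤n+m (2 * b) t))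

module ControlSequence (p b : ℕ) .{{_ : NonZero (p + 2 * b)}} (2b≤p : 2 * b ≤ p) where

  q : ℕ
  q = p + 2 * b

  open Reduction q
  open Windows b q

  b≤p : b ≤ p
  b≤p = ≤-trans (m≤m+n b (b + 0)) 2b≤p

  b≤q : b ≤ q
  b≤q = ≤-trans b≤p (m≤m+n p (2 * b))

  wrap⇔ : ∀ {s x} → x + q ≤ s + p ⇔ x + 2 * b ≤ s
  wrap⇔ {s} {x} = mk⇔
    (λ le → +-cancelʳ-≤ p (x + 2 * b) s (subst (_≤ s + p) (x∙yz≈xz∙y x p (2 * b)) le))
    (λ le → subst (_≤ s + p) (sym (x∙yz≈xz∙y x p (2 * b))) (+-monoˡ-≤ p le))

  arc-low : ∀ {x} → x ≤ b → ∀ n → Arc p (n % q) x ⇔ (¬ Window (x + b) ((b + n) % q))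
  arc-low {x} x≤b n with carry? b≤q n
  ... | no-carry r≡s+b _ rewrite r≡s+b = mk⇔ to from
    where
      s = n % q
      to : Arc p s x → ¬ Window (x + b) (s + b)
      to arc w with Equivalence.to (window-shift {x} {s} b) w
      to (inj₁ (s<x , _)) _ | x≤s , _        = <⇒≱ s<x x≤s
      to (inj₂ wrap)      _ | _   , s<x+2b   = <⇒≱ s<x+2b (Equivalence.to (wrap⇔ {s} {x}) wrap)
      from : ¬ Window (x + b) (s + b) → Arc p s x
      from ¬w with s <? x
      ... | yes s<x = inj₁ (s<x , ≤-trans x≤b (≤-trans b≤p (m≤n+m p s)))
      ... | no s≮x  = inj₂ (Equivalence.from (wrap⇔ {s} {x}) (≮⇒≥ λ s<x+2b →
                        ¬w (Equivalence.from (window-shift {x} {s} b) (≮⇒≥ s≮x , s<x+2b))))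
  ... | carry r+q≡s+b _ = mk⇔
    (λ _ (x+b≤r , _) → <⇒≱ (carry⇒r<b (m%n<n n q) r+q≡s+b) (≤-trans (m≤n+m b x) x+b≤r))
    (λ _ → inj₂ (Equivalence.from (wrap⇔ {n % q} {x}) (carry⇒≤ {r = (b + n) % q} x+2b+b≤q r+q≡s+b)))
    where
      x+2b+b≤q : x + 2 * b + b ≤ q
      x+2b+b≤q = begin
        x + 2 * b + b      ≤⟨ +-monoˡ-≤ b (+-monoˡ-≤ (2 * b) x≤b) ⟩
        b + 2 * b + b      ≡⟨ lemma b ⟩
        2 * b + 2 * b      ≤⟨ +-monoˡ-≤ (2 * b) 2b≤p ⟩
        q                  ∎
        where
          open ≤-Reasoning
          lemma : ∀ b → b + 2 * b + b ≡ 2 * b + 2 * b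
          lemma = solve-∀

  private
    shift-high : ∀ t → t + (p + b) + b ≡ t + q
    shift-high t = lemma t p b
      where
        lemma : ∀ t p b → t + (p + b) + b ≡ t + (p + 2 * b)
        lemma = solve-∀

    high-unwrapped : ∀ {t s} → s < q → ¬ (t + (p + b) + q ≤ s + p)
    high-unwrapped {t} {s} s<q = <⇒≱ (begin-strict
      s + p                 <⟨ +-monoˡ-< p s<q ⟩
      q + p                 ≡⟨ +-comm q p ⟩
      p + q                 ≤⟨ +-monoˡ-≤ q (≤-trans (m≤m+n p b) (m≤n+m (p + b) t)) ⟩
      t + (p + b) + q       ∎)
      where open ≤-Reasoning

  arc-high : ∀ {t} → t ≤ b → ∀ n → Arc p (n % q) (t + (p + b)) ⇔ (¬ Window t ((b + n) % q))
  arc-high {t} t≤b n with carry? b≤q n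
  ... | no-carry r≡s+b _ = mk⇔ to from
    where
      s = n % q
      r = (b + n) % q
      x = t + (p + b)
      x≡t+b+p : x ≡ t + b + p
      x≡t+b+p = x∙yz≈xz∙y t p b
      to : Arc p s x → ¬ Window t r
      to (inj₁ (_ , x≤s+p)) (_ , r<t+2b) =
        <⇒≱ (+-cancelʳ-< b s (t + b) (subst₂ _<_ r≡s+b (m+2n≡m+n+n t b) r<t+2b))
            (+-cancelʳ-≤ p (t + b) s (subst (_≤ s + p) x≡t+b+p x≤s+p))
      to (inj₂ wrap) _ = high-unwrapped {t} s<q wrap
        where s<q = m%n<n n q
      from : ¬ Window t r → Arc p s x
      from ¬w = inj₁ (s<x , subst (_≤ s + p) (sym x≡t+b+p) (+-monoˡ-≤ p t+b≤s))
        where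
          t≤r : t ≤ r
          t≤r = subst (t ≤_) (sym r≡s+b) (≤-trans t≤b (m≤n+m b s))
          t+b≤s : t + b ≤ s
          t+b≤s = +-cancelʳ-≤ b (t + b) s
                    (subst₂ _≤_ (m+2n≡m+n+n t b) r≡s+b (≮⇒≥ λ r<t+2b → ¬w (t≤r , r<t+2b)))
          s<x : s < x
          s<x = <-≤-trans (+-cancelʳ-< b s (p + b) (subst₂ _<_ r≡s+b (m+2n≡m+n+n p b) (m%n<n (b + n) q)))
                          (m≤n+m (p + b) t)
  ... | carry r+q≡s+b _ = mk⇔ to from
    where
      s = n % q
      r = (b + n) % q
      x = t + (p + b)
      to : Arc p s x → ¬ Window t r
      to (inj₁ (s<x , _)) (t≤r , _) = <⇒≱ s<x (+-cancelʳ-≤ b x s (begin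
        x + b    ≡⟨ shift-high t ⟩
        t + q    ≤⟨ +-monoˡ-≤ q t≤r ⟩
        r + q    ≡⟨ r+q≡s+b ⟩
        s + b    ∎))
        where open ≤-Reasoning
      to (inj₂ wrap) _ = high-unwrapped {t} (m%n<n n q) wrap
      from : ¬ Window t r → Arc p s x
      from ¬w = inj₁ (s<x , x≤s+p)
        where
          open ≤-Reasoning
          r<t : r < t
          r<t = ≰⇒> λ t≤r → ¬w (t≤r , <-≤-trans (carry⇒r<b (m%n<n n q) r+q≡s+b) (n≤m+2n t b))
          s<x : s < x
          s<x = +-cancelʳ-< b s x (begin-strict
            s + b    ≡⟨ r+q≡s+b ⟨
            r + q    <⟨ +-monoˡ-< q r<t ⟩
            t + q    ≡⟨ shift-high t ⟨
            x + b    ∎)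
          x≤s+p : x ≤ s + p
          x≤s+p = begin
            x              ≤⟨ +-monoˡ-≤ (p + b) t≤b ⟩
            b + (p + b)    ≡⟨ lemma p b ⟩
            q              ≤⟨ m≤n+m q r ⟩
            r + q          ≡⟨ r+q≡s+b ⟩
            s + b          ≤⟨ +-monoʳ-≤ s b≤p ⟩
            s + p          ∎
            where
              lemma : ∀ p b → b + (p + b) ≡ p + 2 * b
              lemma = solve-∀

  AbsenceWindow : ℕ → ℕ → Set
  AbsenceWindow x t = ∀ m → inBracket p q b (suc m) x ≡ not (does (window? t (suc m * b % q)))

  absence-window : ∀ {x t} → 1 ≤ x → x ≤ q →
                   (∀ n → Arc p (n % q) x ⇔ (¬ Window t ((b + n) % q))) → AbsenceWindow x t
  absence-window {t = t} 1≤x x≤q arc⇔¬window m =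
    ≡-not-does (arc⇔¬window (m * b) ⇔-∘ bracket⇔arc (m≤m+n p (2 * b)) 1≤x x≤q) (window? t _)

  windowOf : ∀ {x} → TheSet p q b x → ∃[ t ] (1 ≤ t × t ≤ 2 * b × AbsenceWindow x t)
  windowOf {x} (inj₁ (1≤x , x≤b)) =
    x + b , ≤-trans 1≤x (m≤m+n x b) , subst (x + b ≤_) (sym (m+2n≡m+n+n 0 b)) (+-monoˡ-≤ b x≤b) ,
    absence-window 1≤x (≤-trans x≤b b≤q) (arc-low x≤b)
  windowOf {x} (inj₂ (p+b+1≤x , x≤q)) =
    t , m<n⇒0<n∸m p+b<x , ≤-trans t≤b (m≤m+n b (b + 0)) ,
    absence-window (≤-trans (m≤n+m 1 (p + b)) p+b+1≤x) x≤q
      (subst (λ y → ∀ n → Arc p (n % q) y ⇔ (¬ Window t ((b + n) % q))) (m∸n+n≡m (<⇒≤ p+b<x)) (arc-high t≤b))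
    where
      t = x ∸ (p + b)
      p+b<x : p + b < x
      p+b<x = subst (_≤ x) (+-comm (p + b) 1) p+b+1≤x
      t≤b : t ≤ b
      t≤b = m≤n+o⇒m∸n≤o x (p + b) (subst (x ≤_) (m+2n≡m+n+n p b) x≤q)

  occ-formula : ∀ {x t} → AbsenceWindow x t → 1 ≤ t → t ≤ 2 * b →
                ∀ j → occ p q b j x + (2 * (j * b / q) + lapHits t (j * b % q)) ≡ j
  occ-formula {x} absent 1≤t t≤2b j =
    trans (cong (occ p q b j x +_) (sym (hits-formula 1≤t (+-monoˡ-≤ (2 * b) (≤-trans t≤2b 2b≤p)) j)))
          (countUpTo-complement j absent)

  consistent : Consistent p q b (TheSet p q b)
  consistent (suc m) x y _ x∈S y∈S (x∈β , _ , occ≡)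
    with tx , 1≤tx , tx≤2b , absent-x ← windowOf x∈S
       | ty , 1≤ty , ty≤2b , absent-y ← windowOf y∈S =
    contradiction (trans (sym x∈β) x∉β) λ ()
    where
      j = suc m
      k = j * b / q
      r = j * b % q
      ox = occ p q b j x
      gap : lapHits tx r ≡ 2 + lapHits ty r
      gap = +-cancelˡ-≡ (2 * k) _ _ (+-cancelˡ-≡ ox _ _ (begin
        ox + (2 * k + lapHits tx r)          ≡⟨ occ-formula absent-x 1≤tx tx≤2b j ⟩
        j                                    ≡⟨ occ-formula absent-y 1≤ty ty≤2b j ⟨
        occ p q b j y + (2 * k + lapHits ty r) ≡⟨ cong (_+ (2 * k + lapHits ty r)) occ≡ ⟩
        ox + 2 + (2 * k + lapHits ty r)       ≡⟨ +-assoc ox 2 _ ⟩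
        ox + (2 + (2 * k + lapHits ty r))     ≡⟨ cong (ox +_) (x∙yz≈y∙xz 2 (2 * k) _) ⟩
        ox + (2 * k + (2 + lapHits ty r))     ∎))
        where open ≡-Reasoning
      x∉β : inBracket p q b j x ≡ false
      x∉β = trans (absent-x m) (cong not (dec-true (window? tx r) (lapHits-gap ty≤2b gap)))

lemma16 : (p q b : ℕ) .{{_ : NonZero q}} → 0 < p → p < q → q ≡ p + 2 * b → 2 * b ≤ p →
          Consistent p q b (TheSet p q b)
-- 0 < p and p < q only exclude degenerate cases in which the set is empty.
lemma16 p .(p + 2 * b) b _ _ refl 2b≤p = ControlSequence.consistent p b 2b≤p
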